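{- The encoding $\mathcal{F}$ is a bijection between the set of ground higher-order terms over $\Sigma$ and the set of ground (well-typed) first-order terms over the first-order signature $\mathcal{F}(\Sigma)$.
   Context: Higher-order setting: polymorphic higher-order logic with locally nameless syntax (De Bruijn indices). Types are type variables or applied type constructors, including Boolean $o$ and function type $\to$. Constants $\mathsf{f}$ have declarations $\Pi\bar\alpha_m.\,\bar\tau_n\Rightarrow\upsilon$ where $\bar\tau_n$ are the parameter types; a symbol occurrence is $\mathsf{f}\langle\bar\upsilon\rangle(\bar u)$ with type arguments $\bar\upsilon$ and parameters $\bar u$ (which contain no free De Bruijn indices). Terms are $\beta\eta$-equivalence classes of locally closed $\lambda$-preterms (built from variables, symbols, De Bruijn indices, $\lambda$-abstractions and applications); a term is ground if it contains no type or term variables. A term is functional if its type has the form $\tau\to\upsilon$. A nonfunctional ground term in $\beta$-normal form has the form $\mathsf{f}\langle\bar\tau\rangle(\bar u)\,\bar t_m$. Yellow subterms: orange subterms (subterms reachable through ordinary arguments of symbol-headed and De Bruijn-index-headed applications and through bodies of $\lambda$-abstractions, but not through parameters, not through arguments of applied variables and not in head position) that contain no free De Bruijn indices. First-order signature $\mathcal{F}(\Sigma)$: same type constructors, with $\to$ treated as an uninterpreted type constructor. For each ground higher-order term of the form $\mathsf{f}\langle\bar\tau\rangle(\bar u):\tau_1\to\cdots\to\tau_m\to\tau$ ($m\ge0$) there is a first-order symbol $\mathsf{f}^{\bar\tau}_{\bar u}:\tau_1\times\cdots\times\tau_m\Rightarrow\tau$. Moreover, for each expression $t$ obtained by replacing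 each outermost proper yellow subterm of a higher-order term of type $\tau\to\upsilon$ by a placeholder symbol $\square$, there is a first-order symbol $\mathsf{fun}_t:\tau_1\times\cdots\times\tau_n\Rightarrow(\tau\to\upsilon)$, where $\tau_1,\dots,\tau_n$ are the types of the replaced subterms in order of occurrence. Encoding $\mathcal{F}$ on ground terms, defined recursively: if $t$ is functional, let $t'$ be obtained by replacing each outermost proper yellow subterm of $t$ by $\square$, and set $\mathcal{F}(t)=\mathsf{fun}_{t'}(\mathcal{F}(s_1),\dots,\mathcal{F}(s_n))$ where $s_1,\dots,s_n$ are the replaced subterms in order of occurrence; otherwise $t=\mathsf{f}\langle\bar\tau\rangle(\bar u)\,t_1\cdots t_m$ and $\mathcal{F}(t)=\mathsf{f}^{\bar\tau}_{\bar u}(\mathcal{F}(t_1),\dots,\mathcal{F}(t_m))$. -}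

module Defs where

open import Data.Nat using (ℕ)
open import Data.Fin using (Fin)
open import Data.Vec using (Vec; []; _∷_; lookup)
open import Data.List using (List; []; _∷_; _++_; map)
open import Data.List.Relation.Unary.All using (All; []; _∷_)
open import Data.Product using (Σ; _×_; _,_; proj₁; proj₂)
open import Data.Maybe using (Maybe; just; nothing; _>>=_)
open import Data.Bool using (Bool; true; false)
open import Relation.Binary.PropositionalEquality using (_≡_; refl)

-- Type variables are Fin n (de Bruijn for the Π-bound type
-- variables of a declaration); o and → are built in; every other type
-- constructor κ comes from the signature together with its arity.

module Types (TyCon : Set) (arity : TyCon → ℕ) where

  infixr 5 _⇒_

  data Ty (n : ℕ) : Set where
    tv  : Fin n → Ty n
    o   : Ty n
    _⇒_ : Ty n → Ty n → Ty n
    con : (κ : TyCon) → Vec (Ty n) (arity κ) → Ty n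

  GTy : Set
  GTy = Ty 0

  mutual
    sub : ∀ {n} → Ty n → Vec GTy n → GTy
    sub (tv i)     σ = lookup σ i
    sub o          σ = o
    sub (a ⇒ b)    σ = sub a σ ⇒ sub b σ
    sub (con κ as) σ = con κ (subs as σ)

    subs : ∀ {n k} → Vec (Ty n) k → Vec GTy n → Vec GTy k
    subs []       σ = []
    subs (a ∷ as) σ = sub a σ ∷ subs as σ

  data Base : GTy → Set where
    o   : Base o
    con : ∀ κ as → Base (con κ as)

-- Higher-order signature Σ: constants f : Π ᾱ_m. τ̄_n ⇒ υ

record Signature : Set₁ where
  field
    TyCon    : Set
    arity    : TyCon → ℕ
    Sym      : Set
    tyArity  : Sym → ℕ
    paramTys : (f : Sym) → List (Types.Ty TyCon arity (tyArity f))
    resTy    : (f : Sym) → Types.Ty TyCon arity (tyArity f)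

module Enc (S : Signature) where
  open Signature S public
  open Types TyCon arity public

  Ctx : Set
  Ctx = List GTy

  -- De Bruijn indices (index 0 = innermost binder)
  data _∋_ : Ctx → GTy → Set where
    here  : ∀ {Γ τ} → (τ ∷ Γ) ∋ τ
    there : ∀ {Γ σ τ} → Γ ∋ τ → (σ ∷ Γ) ∋ τ

  instP : (f : Sym) → Vec GTy (tyArity f) → List GTy
  instP f ts = map (λ a → sub a ts) (paramTys f)

  instR : (f : Sym) → Vec GTy (tyArity f) → GTy
  instR f ts = sub (resTy f) ts

  -- Ground, locally closed terms, as canonical representatives of their
  -- βη-classes: β-normal η-long forms, intrinsically typed, with
  -- De Bruijn indices bound in the context Γ.  The Bool index says
  -- whether the placeholder □ ('hole') may occur (true: expressions
  -- with placeholders; false: genuine terms).  Applications are head + spine; a head applied to a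
  -- spine always has nonfunctional type (η-long).

  mutual
    data Nf : Bool → Ctx → GTy → Set where
      lam  : ∀ {b Γ σ τ} → Nf b (σ ∷ Γ) τ → Nf b Γ (σ ⇒ τ)
      sym  : ∀ {b Γ τ} (f : Sym) (ts : Vec GTy (tyArity f)) →
             All (Nf false []) (instP f ts) →
             Sp b Γ (instR f ts) τ → Base τ → Nf b Γ τ
      var  : ∀ {b Γ σ τ} → Γ ∋ σ → Sp b Γ σ τ → Base τ → Nf b Γ τ
      hole : ∀ {Γ} (τ : GTy) → Nf true Γ τ

    data Sp : Bool → Ctx → GTy → GTy → Set where
      []  : ∀ {b Γ τ} → Sp b Γ τ τ
      _∷_ : ∀ {b Γ σ τ υ} → Nf b Γ σ → Sp b Γ τ υ → Sp b Γ (σ ⇒ τ) υ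

  Term : GTy → Set
  Term τ = Nf false [] τ

  -- "contains no free De Bruijn index": strengthening to the empty
  -- context succeeds.

  Ren : Ctx → Ctx → Set
  Ren Γ Δ = ∀ {σ} → Γ ∋ σ → Maybe (Δ ∋ σ)

  lift : ∀ {Γ Δ σ} → Ren Γ Δ → Ren (σ ∷ Γ) (σ ∷ Δ)
  lift ρ here      = just here
  lift ρ (there x) = ρ x >>= λ y → just (there y)

  mutual
    str : ∀ {Γ Δ τ} → Ren Γ Δ → Nf false Γ τ → Maybe (Nf false Δ τ)
    str ρ (lam t)            = str (lift ρ) t >>= λ t' → just (lam t')
    str ρ (sym f ts ps sp β) = strSp ρ sp >>= λ sp' → just (sym f ts ps sp' β)
    str ρ (var x sp β)       = ρ x >>= λ y → strSp ρ sp >>= λ sp' → just (var y sp' β)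

    strSp : ∀ {Γ Δ σ τ} → Ren Γ Δ → Sp false Γ σ τ → Maybe (Sp false Δ σ τ)
    strSp ρ []       = just []
    strSp ρ (t ∷ sp) = str ρ t >>= λ t' → strSp ρ sp >>= λ sp' → just (t' ∷ sp')

  close : ∀ {Γ τ} → Nf false Γ τ → Maybe (Term τ)
  close = str (λ _ → nothing)

  -- Replacing the outermost proper yellow subterms by □.
  -- Orange positions: ordinary arguments of symbol- and De-Bruijn-headed
  -- applications and bodies of λ-abstractions (not parameters, not
  -- heads).  Yellow = orange and without free De Bruijn indices.
  -- cutIn t returns t' together with the replaced subterms s₁ … sₙ
  -- (with their types) in order of occurrence.

  Sub : Set
  Sub = Σ GTy Term

  choose : ∀ {Γ τ} → Maybe (Term τ) → Nf true Γ τ × List Sub → Nf true Γ τ × List Sub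
  choose {τ = τ} (just s) _ = hole τ , (τ , s) ∷ []
  choose nothing r = r

  mutual
    cutAt : ∀ {Γ τ} → Nf false Γ τ → Nf true Γ τ × List Sub
    cutAt t = choose (close t) (cutIn t)

    cutIn : ∀ {Γ τ} → Nf false Γ τ → Nf true Γ τ × List Sub
    cutIn (lam t) with cutAt t
    ... | t' , l = lam t' , l
    cutIn (sym f ts ps sp β) with cutSp sp
    ... | sp' , l = sym f ts ps sp' β , l
    cutIn (var x sp β) with cutSp sp
    ... | sp' , l = var x sp' β , l

    cutSp : ∀ {Γ σ τ} → Sp false Γ σ τ → Sp true Γ σ τ × List Sub
    cutSp [] = [] , []
    cutSp (t ∷ sp) with cutAt t | cutSp sp
    ... | t' , l₁ | sp' , l₂ = t' ∷ sp' , l₁ ++ l₂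

  mutual
    holeTys : ∀ {Γ τ} → Nf true Γ τ → List GTy
    holeTys (lam t)            = holeTys t
    holeTys (sym f ts ps sp β) = holeTysSp sp
    holeTys (var x sp β)       = holeTysSp sp
    holeTys (hole τ)           = τ ∷ []

    holeTysSp : ∀ {Γ σ τ} → Sp true Γ σ τ → List GTy
    holeTysSp []       = []
    holeTysSp (t ∷ sp) = holeTys t ++ holeTysSp sp

  IsFunExpr : ∀ {σ τ} → Nf true [] (σ ⇒ τ) → Set
  IsFunExpr {σ} {τ} t' = Σ (Term (σ ⇒ τ)) (λ t → proj₁ (cutIn t) ≡ t')

  -- Ground well-typed first-order terms over F(Σ).
  -- fsym f ts ps : the symbol f^{ts}_{ps} : τ₁ × … × τₘ ⇒ τ where
  --   f⟨ts⟩(ps) : τ₁ → … → τₘ → τ with τ nonfunctional;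
  -- fun t' _ : the symbol fun_{t'} : τ₁ × … × τₙ ⇒ (σ → τ), the τᵢ being
  --   the placeholder types; the (irrelevant) second argument restricts
  --   to those t' that arise as described, so the symbol is t' itself.

  mutual
    data FTm : GTy → Set where
      fsym : ∀ {τ} (f : Sym) (ts : Vec GTy (tyArity f))
             (ps : All (Nf false []) (instP f ts)) →
             FArgs (instR f ts) τ → Base τ → FTm τ
      fun  : ∀ {σ τ} (t' : Nf true [] (σ ⇒ τ)) → .(IsFunExpr t') →
             All FTm (holeTys t') → FTm (σ ⇒ τ)

    data FArgs : GTy → GTy → Set where
      []  : ∀ {τ} → FArgs τ τ
      _∷_ : ∀ {σ τ υ} → FTm σ → FArgs τ υ → FArgs (σ ⇒ τ) υ

  -- The encoding F, given by its graph  t ↦ F(t)  (the recursion passes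
  -- through the replaced subterms, which are not syntactic subterms of
  -- the representation, so it is given as an inductive relation
  -- following the recursive definition clause by clause).

  infix 4 _↦_ _↦ˢ_ _↦*_

  mutual
    data _↦_ : ∀ {τ} → Term τ → FTm τ → Set where
      sym : ∀ {τ f ts ps β} {sp : Sp false [] (instR f ts) τ} {us} →
            sp ↦ˢ us → sym f ts ps sp β ↦ fsym f ts ps us β
      lam : ∀ {σ τ} {b : Nf false (σ ∷ []) τ}
              {us : All FTm (holeTys (proj₁ (cutIn (lam b))))} →
            proj₂ (cutIn (lam b)) ↦* us →
            lam b ↦ fun (proj₁ (cutIn (lam b))) (lam b , refl) us

    data _↦ˢ_ : ∀ {σ τ} → Sp false [] σ τ → FArgs σ τ → Set where
      []  : ∀ {τ} → _↦ˢ_ {τ} {τ} [] []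
      _∷_ : ∀ {σ τ υ} {t : Term σ} {u} {sp : Sp false [] τ υ} {us} →
            t ↦ u → sp ↦ˢ us → (t ∷ sp) ↦ˢ (u ∷ us)

    data _↦*_ : List Sub → ∀ {tys} → All FTm tys → Set where
      []  : [] ↦* []
      _∷_ : ∀ {τ t u l tys} {us : All FTm tys} →
            t ↦ u → l ↦* us → ((τ , t) ∷ l) ↦* (u ∷ us)

-- F(t) is computed by recursion on the size of t: the subterms replaced by □ are
-- strengthenings of proper subterms of t, hence smaller.  Cutting and filling are
-- mutually inverse.  Filling the holes of the expression cut out of t with the
-- replaced subterms gives back t.  Conversely, if the holes of an expression sit
-- exactly at its outermost proper yellow positions, filling them with arbitrary closed
-- terms and cutting again returns the expression and those terms, because filling
-- holes with closed terms does not change which orange subterms have free De Bruijn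
-- indices.  The expression t' of every symbol fun_{t'} has this decidable shape, so F
-- is injective and surjective by induction on the encoding derivations.
module Submission where

open import Defs
open import Data.Bool using (true; false)
open import Data.Empty using (⊥)
open import Data.Unit using (⊤; tt)
open import Data.List using (List; []; _∷_; _++_)
open import Data.List.Properties using (∷-injective)
open import Data.List.Relation.Unary.All using (All; []; _∷_; toList)
import Data.List.Relation.Unary.All as All
open import Data.List.Relation.Unary.All.Properties using (++⁺; ++⁻; ++↔)
open import Data.Maybe using (Maybe; just; nothing; _>>=_)
open import Data.Nat using (ℕ; zero; suc; _+_; _≤_; _<_; s≤s)
open import Data.Nat.Properties using (≤-refl; ≤-reflexive; ≤-trans; m≤m+n; m≤n+m; <⇒≤)
open import Data.Product using (Σ; ∃; ∃!; _×_; _,_; proj₁; proj₂)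
open import Data.Sum using (_⊎_; inj₁; inj₂)
import Data.Sum as Sum
open import Function using (id; _∘_)
open import Function.Bundles using (Inverse)
open import Relation.Nullary using (Dec; yes; no)
open import Relation.Nullary.Decidable using (_×-dec_; _⊎-dec_; recompute)
open import Relation.Binary.PropositionalEquality
  using (_≡_; refl; trans; cong; cong₂; subst; module ≡-Reasoning) renaming (sym to ≡-sym)

module _ {A B : Set} where

  >>=-nothing⁺ : {m : Maybe A} {f : A → Maybe B} → m ≡ nothing → (m >>= f) ≡ nothing
  >>=-nothing⁺ refl = refl

  >>=-just-nothing⁻ : (m : Maybe A) {f : A → B} →
                      (m >>= λ x → just (f x)) ≡ nothing → m ≡ nothing
  >>=-just-nothing⁻ nothing _ = refl

module _ {A B C : Set} where

  >>=²-nothing⁺ : {m : Maybe A} {n : Maybe B} {f : A → B → Maybe C} →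
                  m ≡ nothing ⊎ n ≡ nothing → (m >>= λ x → n >>= f x) ≡ nothing
  >>=²-nothing⁺ {m = nothing} _           = refl
  >>=²-nothing⁺ {m = just _}  (inj₂ refl) = refl

  >>=²-just-nothing⁻ : (m : Maybe A) {n : Maybe B} {f : A → B → C} →
                       (m >>= λ x → n >>= λ y → just (f x y)) ≡ nothing →
                       m ≡ nothing ⊎ n ≡ nothing
  >>=²-just-nothing⁻ nothing                _ = inj₁ refl
  >>=²-just-nothing⁻ (just _) {n = nothing} _ = inj₂ refl

nothing? : {A : Set} (m : Maybe A) → Dec (m ≡ nothing)
nothing? nothing  = yes refl
nothing? (just _) = no λ ()

module _ {A : Set} {P : A → Set} where

  ++⁻∘++⁺ : ∀ {xs ys} (p : All P xs) (q : All P ys) → ++⁻ xs (++⁺ p q) ≡ (p , q)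
  ++⁻∘++⁺ p q = Inverse.strictlyInverseʳ ++↔ (p , q)

  ++⁺∘++⁻ : ∀ xs {ys} (p : All P (xs ++ ys)) → let q , r = ++⁻ xs p in ++⁺ q r ≡ p
  ++⁺∘++⁻ xs p = Inverse.strictlyInverseˡ (++↔ {xs = xs}) p

  toList-++⁺ : ∀ {xs ys} (p : All P xs) (q : All P ys) →
               toList (++⁺ p q) ≡ toList p ++ toList q
  toList-++⁺ []       q = refl
  toList-++⁺ (p ∷ ps) q = cong (_ ∷_) (toList-++⁺ ps q)

  toList-injective : ∀ {xs} (p q : All P xs) → toList p ≡ toList q → p ≡ q
  toList-injective []       []       _ = refl
  toList-injective (p ∷ ps) (q ∷ qs) e with ∷-injective e
  ... | refl , e′ = cong (p ∷_) (toList-injective ps qs e′)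

module Encoding (S : Signature) where
  open Enc S
  open ≡-Reasoning

  private variable
    Γ Δ Θ : Ctx
    σ τ υ : GTy

  Rename : Ctx → Ctx → Set
  Rename Γ Δ = ∀ {σ} → Γ ∋ σ → Δ ∋ σ

  ext : Rename Γ Δ → Rename (σ ∷ Γ) (σ ∷ Δ)
  ext ρ here      = here
  ext ρ (there x) = there (ρ x)

  mutual
    ren : Rename Γ Δ → Nf false Γ τ → Nf false Δ τ
    ren ρ (lam t)            = lam (ren (ext ρ) t)
    ren ρ (sym f ts ps sp β) = sym f ts ps (renSp ρ sp) β
    ren ρ (var x sp β)       = var (ρ x) (renSp ρ sp) β

    renSp : Rename Γ Δ → Sp false Γ σ τ → Sp false Δ σ τ
    renSp ρ []       = []
    renSp ρ (t ∷ sp) = ren ρ t ∷ renSp ρ sp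

  weaken : Term τ → Nf false Γ τ
  weaken = ren λ ()

  ext-id : {ρ : Rename Γ Γ} → (∀ {σ} (x : Γ ∋ σ) → ρ x ≡ x) →
           (x : (σ ∷ Γ) ∋ υ) → ext ρ x ≡ x
  ext-id h here      = refl
  ext-id h (there x) = cong there (h x)

  mutual
    ren-id : {ρ : Rename Γ Γ} → (∀ {σ} (x : Γ ∋ σ) → ρ x ≡ x) →
             (t : Nf false Γ τ) → ren ρ t ≡ t
    ren-id h (lam t)            = cong lam (ren-id (ext-id h) t)
    ren-id h (sym f ts ps sp β) = cong (λ sp → sym f ts ps sp β) (renSp-id h sp)
    ren-id h (var x sp β)       = cong₂ (λ x sp → var x sp β) (h x) (renSp-id h sp)

    renSp-id : {ρ : Rename Γ Γ} → (∀ {σ} (x : Γ ∋ σ) → ρ x ≡ x) →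
               (sp : Sp false Γ σ τ) → renSp ρ sp ≡ sp
    renSp-id h []       = refl
    renSp-id h (t ∷ sp) = cong₂ _∷_ (ren-id h t) (renSp-id h sp)

  ext-lift : {ρ₀ : Rename Γ Δ} {ρ : Ren Δ Θ} {ρ₁ : Rename Γ Θ} →
             (∀ {σ} (x : Γ ∋ σ) → ρ (ρ₀ x) ≡ just (ρ₁ x)) →
             (x : (σ ∷ Γ) ∋ υ) → lift ρ (ext ρ₀ x) ≡ just (ext ρ₁ x)
  ext-lift h here                  = refl
  ext-lift h (there x) rewrite h x = refl

  mutual
    str-ren : {ρ₀ : Rename Γ Δ} {ρ : Ren Δ Θ} {ρ₁ : Rename Γ Θ} →
              (∀ {σ} (x : Γ ∋ σ) → ρ (ρ₀ x) ≡ just (ρ₁ x)) →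
              (t : Nf false Γ τ) → str ρ (ren ρ₀ t) ≡ just (ren ρ₁ t)
    str-ren h (lam t)            = cong (_>>= _) (str-ren (ext-lift h) t)
    str-ren h (sym f ts ps sp β) = cong (_>>= _) (strSp-ren h sp)
    str-ren h (var x sp β)       =
      cong₂ (λ m n → m >>= λ y → n >>= λ sp′ → just (var y sp′ β)) (h x) (strSp-ren h sp)

    strSp-ren : {ρ₀ : Rename Γ Δ} {ρ : Ren Δ Θ} {ρ₁ : Rename Γ Θ} →
                (∀ {σ} (x : Γ ∋ σ) → ρ (ρ₀ x) ≡ just (ρ₁ x)) →
                (sp : Sp false Γ σ τ) → strSp ρ (renSp ρ₀ sp) ≡ just (renSp ρ₁ sp)
    strSp-ren h []       = refl
    strSp-ren h (t ∷ sp) =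
      cong₂ (λ m n → m >>= λ t′ → n >>= λ sp′ → just (t′ ∷ sp′))
            (str-ren h t) (strSp-ren h sp)

  str-weaken : (ρ : Ren Γ Δ) (s : Term τ) → str ρ (weaken s) ≡ just (weaken s)
  str-weaken ρ = str-ren λ ()

  close-weaken : (s : Term τ) → close {Γ} (weaken s) ≡ just s
  close-weaken s = trans (str-ren {ρ₁ = id} (λ ()) s) (cong just (ren-id (λ ()) s))

  LeftInverse : Rename Δ Γ → Ren Γ Δ → Set
  LeftInverse {Γ = Γ} ρ′ ρ = ∀ {σ} (x : Γ ∋ σ) {y} → ρ x ≡ just y → ρ′ y ≡ x

  ext-leftInverse : {ρ′ : Rename Δ Γ} {ρ : Ren Γ Δ} →
                    LeftInverse ρ′ ρ → LeftInverse (ext {σ = σ} ρ′) (lift ρ)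
  ext-leftInverse h here refl = refl
  ext-leftInverse {ρ = ρ} h (there x) e with ρ x in eq | e
  ... | just y | refl = cong there (h x eq)

  mutual
    ren-str : {ρ′ : Rename Δ Γ} {ρ : Ren Γ Δ} → LeftInverse ρ′ ρ →
              (t : Nf false Γ τ) {s : Nf false Δ τ} → str ρ t ≡ just s → ren ρ′ s ≡ t
    ren-str {ρ = ρ} h (lam t) e with str (lift ρ) t in eq | e
    ... | just _ | refl = cong lam (ren-str (ext-leftInverse h) t eq)
    ren-str {ρ = ρ} h (sym f ts ps sp β) e with strSp ρ sp in eq | e
    ... | just _ | refl = cong (λ sp → sym f ts ps sp β) (renSp-str h sp eq)
    ren-str {ρ = ρ} h (var x sp β) e with ρ x in eq₁ | strSp ρ sp in eq₂ | e
    ... | just _ | just _ | refl = cong₂ (λ x sp → var x sp β) (h x eq₁) (renSp-str h sp eq₂)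

    renSp-str : {ρ′ : Rename Δ Γ} {ρ : Ren Γ Δ} → LeftInverse ρ′ ρ →
                (sp : Sp false Γ σ τ) {sp′ : Sp false Δ σ τ} →
                strSp ρ sp ≡ just sp′ → renSp ρ′ sp′ ≡ sp
    renSp-str h [] refl = refl
    renSp-str {ρ = ρ} h (t ∷ sp) e with str ρ t in eq₁ | strSp ρ sp in eq₂ | e
    ... | just _ | just _ | refl = cong₂ _∷_ (ren-str h t eq₁) (renSp-str h sp eq₂)

  weaken-close : (t : Nf false Γ τ) {s : Term τ} → close t ≡ just s → weaken s ≡ t
  weaken-close = ren-str λ _ ()

  mutual
    size : Nf false Γ τ → ℕ
    size (lam t)            = suc (size t)
    size (sym f ts ps sp β) = suc (sizeSp sp)
    size (var x sp β)       = suc (sizeSp sp)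

    sizeSp : Sp false Γ σ τ → ℕ
    sizeSp []       = zero
    sizeSp (t ∷ sp) = size t + sizeSp sp

  mutual
    size-ren : (ρ : Rename Γ Δ) (t : Nf false Γ τ) → size (ren ρ t) ≡ size t
    size-ren ρ (lam t)            = cong suc (size-ren (ext ρ) t)
    size-ren ρ (sym f ts ps sp β) = cong suc (sizeSp-ren ρ sp)
    size-ren ρ (var x sp β)       = cong suc (sizeSp-ren ρ sp)

    sizeSp-ren : (ρ : Rename Γ Δ) (sp : Sp false Γ σ τ) → sizeSp (renSp ρ sp) ≡ sizeSp sp
    sizeSp-ren ρ []       = refl
    sizeSp-ren ρ (t ∷ sp) = cong₂ _+_ (size-ren ρ t) (sizeSp-ren ρ sp)

  size-close : (t : Nf false Γ τ) {s : Term τ} → close t ≡ just s → size s ≡ size t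
  size-close t e = trans (≡-sym (size-ren _ _)) (cong size (weaken-close t e))

  mutual
    strH : Ren Γ Δ → Nf true Γ τ → Maybe (Nf true Δ τ)
    strH ρ (lam c)            = strH (lift ρ) c >>= λ c′ → just (lam c′)
    strH ρ (sym f ts ps sp β) = strHSp ρ sp >>= λ sp′ → just (sym f ts ps sp′ β)
    strH ρ (var x sp β)       = ρ x >>= λ y → strHSp ρ sp >>= λ sp′ → just (var y sp′ β)
    strH ρ (hole τ)           = just (hole τ)

    strHSp : Ren Γ Δ → Sp true Γ σ τ → Maybe (Sp true Δ σ τ)
    strHSp ρ []       = just []
    strHSp ρ (c ∷ sp) = strH ρ c >>= λ c′ → strHSp ρ sp >>= λ sp′ → just (c′ ∷ sp′)

  closeH : Nf true Γ τ → Maybe (Nf true [] τ)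
  closeH = strH λ _ → nothing

  mutual
    fill : (c : Nf true Γ τ) → All Term (holeTys c) → Nf false Γ τ
    fill (lam c)            ss       = lam (fill c ss)
    fill (sym f ts ps sp β) ss       = sym f ts ps (fillSp sp ss) β
    fill (var x sp β)       ss       = var x (fillSp sp ss) β
    fill (hole τ)           (s ∷ []) = weaken s

    fillSp : (sp : Sp true Γ σ τ) → All Term (holeTysSp sp) → Sp false Γ σ τ
    fillSp []       _  = []
    fillSp (c ∷ sp) ss = let ss₁ , ss₂ = ++⁻ (holeTys c) ss in fill c ss₁ ∷ fillSp sp ss₂

  mutual
    str-fill : (ρ : Ren Γ Δ) (c : Nf true Γ τ) (ss : All Term (holeTys c)) →
               strH ρ c ≡ nothing → str ρ (fill c ss) ≡ nothing
    str-fill ρ (lam c) ss e =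
      >>=-nothing⁺ (str-fill (lift ρ) c ss (>>=-just-nothing⁻ (strH (lift ρ) c) e))
    str-fill ρ (sym f ts ps sp β) ss e =
      >>=-nothing⁺ (strSp-fillSp ρ sp ss (>>=-just-nothing⁻ (strHSp ρ sp) e))
    str-fill ρ (var x sp β) ss e =
      >>=²-nothing⁺ (Sum.map₂ (strSp-fillSp ρ sp ss) (>>=²-just-nothing⁻ (ρ x) e))

    strSp-fillSp : (ρ : Ren Γ Δ) (sp : Sp true Γ σ τ) (ss : All Term (holeTysSp sp)) →
                   strHSp ρ sp ≡ nothing → strSp ρ (fillSp sp ss) ≡ nothing
    strSp-fillSp ρ []       _  ()
    strSp-fillSp ρ (c ∷ sp) ss e =
      let ss₁ , ss₂ = ++⁻ (holeTys c) ss in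
      >>=²-nothing⁺ (Sum.map (str-fill ρ c ss₁) (strSp-fillSp ρ sp ss₂)
                             (>>=²-just-nothing⁻ (strH ρ c) e))

  str-closed : (ρ : Ren Γ Δ) (t : Nf false Γ τ) {s : Term τ} →
               close t ≡ just s → str ρ t ≡ just (weaken s)
  str-closed ρ t {s} e =
    subst (λ t → str ρ t ≡ just (weaken s)) (weaken-close t e) (str-weaken ρ s)

  mutual
    strH-cutAt : (ρ : Ren Γ Δ) (t : Nf false Γ τ) →
                 str ρ t ≡ nothing → strH ρ (proj₁ (cutAt t)) ≡ nothing
    strH-cutAt ρ t e with close t in eq
    ... | just s  with () ← trans (≡-sym e) (str-closed ρ t eq)
    ... | nothing = strH-cutIn ρ t e

    strH-cutIn : (ρ : Ren Γ Δ) (t : Nf false Γ τ) →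
                 str ρ t ≡ nothing → strH ρ (proj₁ (cutIn t)) ≡ nothing
    strH-cutIn ρ (lam t) e =
      >>=-nothing⁺ (strH-cutAt (lift ρ) t (>>=-just-nothing⁻ (str (lift ρ) t) e))
    strH-cutIn ρ (sym f ts ps sp β) e =
      >>=-nothing⁺ (strHSp-cutSp ρ sp (>>=-just-nothing⁻ (strSp ρ sp) e))
    strH-cutIn ρ (var x sp β) e =
      >>=²-nothing⁺ (Sum.map₂ (strHSp-cutSp ρ sp) (>>=²-just-nothing⁻ (ρ x) e))

    strHSp-cutSp : (ρ : Ren Γ Δ) (sp : Sp false Γ σ τ) →
                   strSp ρ sp ≡ nothing → strHSp ρ (proj₁ (cutSp sp)) ≡ nothing
    strHSp-cutSp ρ []       ()
    strHSp-cutSp ρ (t ∷ sp) e =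
      >>=²-nothing⁺ (Sum.map (strH-cutAt ρ t) (strHSp-cutSp ρ sp)
                             (>>=²-just-nothing⁻ (str ρ t) e))

  record Splits (t : Nf false Γ τ) (p : Nf true Γ τ × List Sub) : Set where
    constructor splits
    field
      subterms  : All Term (holeTys (proj₁ p))
      subterms≡ : proj₂ p ≡ toList subterms
      fill≡     : fill (proj₁ p) subterms ≡ t

  record SplitsSp (sp : Sp false Γ σ τ) (p : Sp true Γ σ τ × List Sub) : Set where
    constructor splits
    field
      subterms  : All Term (holeTysSp (proj₁ p))
      subterms≡ : proj₂ p ≡ toList subterms
      fill≡     : fillSp (proj₁ p) subterms ≡ sp

  mutual
    cutAt-splits : (t : Nf false Γ τ) → Splits t (cutAt t)
    cutAt-splits t with close t in eq
    ... | just s  = splits (s ∷ []) refl (weaken-close t eq)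
    ... | nothing = cutIn-splits t

    cutIn-splits : (t : Nf false Γ τ) → Splits t (cutIn t)
    cutIn-splits (lam t) =
      let splits ss l≡ fill≡ = cutAt-splits t in splits ss l≡ (cong lam fill≡)
    cutIn-splits (sym f ts ps sp β) =
      let splits ss l≡ fill≡ = cutSp-splits sp
      in splits ss l≡ (cong (λ sp → sym f ts ps sp β) fill≡)
    cutIn-splits (var x sp β) =
      let splits ss l≡ fill≡ = cutSp-splits sp
      in splits ss l≡ (cong (λ sp → var x sp β) fill≡)

    cutSp-splits : (sp : Sp false Γ σ τ) → SplitsSp sp (cutSp sp)
    cutSp-splits []       = splits [] refl refl
    cutSp-splits (t ∷ sp) =
      let splits ss₁ l₁≡ fill₁≡ = cutAt-splits t
          splits ss₂ l₂≡ fill₂≡ = cutSp-splits sp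
          split≡ = ++⁻∘++⁺ ss₁ ss₂
      in splits (++⁺ ss₁ ss₂)
                (trans (cong₂ _++_ l₁≡ l₂≡) (≡-sym (toList-++⁺ ss₁ ss₂)))
                (cong₂ _∷_ (trans (cong (fill (proj₁ (cutAt t)) ∘ proj₁) split≡) fill₁≡)
                           (trans (cong (fillSp (proj₁ (cutSp sp)) ∘ proj₂) split≡) fill₂≡))

  splits-functional : {t t′ : Nf false Γ τ} {p : Nf true Γ τ × List Sub} →
                      Splits t p → Splits t′ p → t ≡ t′
  splits-functional {p = c , _} (splits ss l≡ refl) (splits ss′ l≡′ refl) =
    cong (fill c) (toList-injective ss ss′ (trans (≡-sym l≡) l≡′))

  cutIn-injective : (t t′ : Nf false Γ τ) → cutIn t ≡ cutIn t′ → t ≡ t′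
  cutIn-injective t t′ e =
    splits-functional (cutIn-splits t) (subst (Splits t′) (≡-sym e) (cutIn-splits t′))

  data IsHole {Γ : Ctx} : Nf true Γ τ → Set where
    hole : IsHole (hole τ)

  isHole? : (c : Nf true Γ τ) → Dec (IsHole c)
  isHole? (lam _)         = no λ ()
  isHole? (sym _ _ _ _ _) = no λ ()
  isHole? (var _ _ _)     = no λ ()
  isHole? (hole _)        = yes hole

  mutual
    IsCutIn : Nf true Γ τ → Set
    IsCutIn (lam c)            = IsCutAt c
    IsCutIn (sym f ts ps sp β) = IsCutSp sp
    IsCutIn (var x sp β)       = IsCutSp sp
    IsCutIn (hole τ)           = ⊥

    IsCutAt : Nf true Γ τ → Set
    IsCutAt c = IsHole c ⊎ (closeH c ≡ nothing × IsCutIn c)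

    IsCutSp : Sp true Γ σ τ → Set
    IsCutSp []       = ⊤
    IsCutSp (c ∷ sp) = IsCutAt c × IsCutSp sp

  mutual
    isCutIn? : (c : Nf true Γ τ) → Dec (IsCutIn c)
    isCutIn? (lam c)            = isCutAt? c
    isCutIn? (sym f ts ps sp β) = isCutSp? sp
    isCutIn? (var x sp β)       = isCutSp? sp
    isCutIn? (hole τ)           = no λ ()

    isCutAt? : (c : Nf true Γ τ) → Dec (IsCutAt c)
    isCutAt? c = isHole? c ⊎-dec (nothing? (closeH c) ×-dec isCutIn? c)

    isCutSp? : (sp : Sp true Γ σ τ) → Dec (IsCutSp sp)
    isCutSp? []       = yes tt
    isCutSp? (c ∷ sp) = isCutAt? c ×-dec isCutSp? sp

  mutual
    cutAt-isCut : (t : Nf false Γ τ) → IsCutAt (proj₁ (cutAt t))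
    cutAt-isCut t with close t in eq
    ... | just _  = inj₁ hole
    ... | nothing = inj₂ (strH-cutIn _ t eq , cutIn-isCut t)

    cutIn-isCut : (t : Nf false Γ τ) → IsCutIn (proj₁ (cutIn t))
    cutIn-isCut (lam t)            = cutAt-isCut t
    cutIn-isCut (sym f ts ps sp β) = cutSp-isCut sp
    cutIn-isCut (var x sp β)       = cutSp-isCut sp

    cutSp-isCut : (sp : Sp false Γ σ τ) → IsCutSp (proj₁ (cutSp sp))
    cutSp-isCut []       = tt
    cutSp-isCut (t ∷ sp) = cutAt-isCut t , cutSp-isCut sp

  isFunExpr⇒isCutIn : {c : Nf true [] (σ ⇒ τ)} → IsFunExpr c → IsCutIn c
  isFunExpr⇒isCutIn (t , refl) = cutIn-isCut t

  mutual
    cutAt-fill : (c : Nf true Γ τ) → IsCutAt c → (ss : All Term (holeTys c)) →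
                 cutAt (fill c ss) ≡ (c , toList ss)
    cutAt-fill {Γ = Γ} (hole τ) (inj₁ hole) (s ∷ []) rewrite close-weaken {Γ = Γ} s = refl
    cutAt-fill c (inj₂ (closeH≡ , isCut)) ss
      rewrite str-fill _ c ss closeH≡ = cutIn-fill c isCut ss

    cutIn-fill : (c : Nf true Γ τ) → IsCutIn c → (ss : All Term (holeTys c)) →
                 cutIn (fill c ss) ≡ (c , toList ss)
    cutIn-fill (lam c) isCut ss =
      cong (λ (c′ , l) → lam c′ , l) (cutAt-fill c isCut ss)
    cutIn-fill (sym f ts ps sp β) isCut ss =
      cong (λ (sp′ , l) → sym f ts ps sp′ β , l) (cutSp-fill sp isCut ss)
    cutIn-fill (var x sp β) isCut ss =
      cong (λ (sp′ , l) → var x sp′ β , l) (cutSp-fill sp isCut ss)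

    cutSp-fill : (sp : Sp true Γ σ τ) → IsCutSp sp → (ss : All Term (holeTysSp sp)) →
                 cutSp (fillSp sp ss) ≡ (sp , toList ss)
    cutSp-fill []       _                 [] = refl
    cutSp-fill (c ∷ sp) (isCutˡ , isCutʳ) ss =
      let ss₁ , ss₂ = ++⁻ (holeTys c) ss in
      begin
        cutSp (fill c ss₁ ∷ fillSp sp ss₂)
          ≡⟨ cong₂ (λ (c′ , l₁) (sp′ , l₂) → c′ ∷ sp′ , l₁ ++ l₂)
                   (cutAt-fill c isCutˡ ss₁) (cutSp-fill sp isCutʳ ss₂) ⟩
        (c ∷ sp , toList ss₁ ++ toList ss₂)
          ≡⟨ cong (c ∷ sp ,_) (≡-sym (toList-++⁺ ss₁ ss₂)) ⟩
        (c ∷ sp , toList (++⁺ ss₁ ss₂))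
          ≡⟨ cong (λ ss → c ∷ sp , toList ss) (++⁺∘++⁻ (holeTys c) ss) ⟩
        (c ∷ sp , toList ss)
      ∎

  mutual
    cutAt-bounded : (t : Nf false Γ τ) → All (λ (_ , s) → size s ≤ size t) (proj₂ (cutAt t))
    cutAt-bounded t with close t in eq
    ... | just _  = ≤-reflexive (size-close t eq) ∷ []
    ... | nothing = All.map <⇒≤ (cutIn-smaller t)

    cutIn-smaller : (t : Nf false Γ τ) → All (λ (_ , s) → size s < size t) (proj₂ (cutIn t))
    cutIn-smaller (lam t)            = All.map s≤s (cutAt-bounded t)
    cutIn-smaller (sym f ts ps sp β) = All.map s≤s (cutSp-bounded sp)
    cutIn-smaller (var x sp β)       = All.map s≤s (cutSp-bounded sp)

    cutSp-bounded : (sp : Sp false Γ σ τ) →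
                    All (λ (_ , s) → size s ≤ sizeSp sp) (proj₂ (cutSp sp))
    cutSp-bounded []       = []
    cutSp-bounded (t ∷ sp) =
      ++⁺ (All.map (λ le → ≤-trans le (m≤m+n (size t) (sizeSp sp))) (cutAt-bounded t))
          (All.map (λ le → ≤-trans le (m≤n+m (sizeSp sp) (size t))) (cutSp-bounded sp))

  ↦-fun⁺ : {c : Nf true [] (σ ⇒ τ)} .{w : IsFunExpr c} {l : List Sub}
           {us : All FTm (holeTys c)} (t : Term (σ ⇒ τ)) →
           cutIn t ≡ (c , l) → l ↦* us → t ↦ fun c w us
  ↦-fun⁺ (lam b) refl ds = lam ds
  ↦-fun⁺ (sym _ _ _ _ ())
  ↦-fun⁺ (var () _ _)

  ↦-fun⁻ : {t : Term (σ ⇒ τ)} {c : Nf true [] (σ ⇒ τ)} .{w : IsFunExpr c}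
           {us : All FTm (holeTys c)} →
           t ↦ fun c w us → ∃ λ l → cutIn t ≡ (c , l) × l ↦* us
  ↦-fun⁻ (lam ds) = _ , refl , ds

  mutual
    encode : ∀ n (t : Term τ) → size t ≤ n → ∃ (t ↦_)
    encode n       (var () _ _)       _
    encode (suc n) (sym f ts ps sp β) (s≤s le) =
      let us , ds = encodeSp n sp le in fsym f ts ps us β , sym ds
    encode (suc n) (lam b)            (s≤s le) =
      let c , _          = cutIn (lam b)
          splits ss l≡ _ = cutIn-splits (lam b)
          bounded        = subst (All _) l≡ (All.map (λ { (s≤s le′) → ≤-trans le′ le })
                                                     (cutIn-smaller (lam b)))
          us , ds        = encodeAll n ss bounded
      in fun c (lam b , refl) us , ↦-fun⁺ (lam b) (cong (c ,_) l≡) ds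

    encodeSp : ∀ n (sp : Sp false [] σ τ) → sizeSp sp ≤ n → ∃ (sp ↦ˢ_)
    encodeSp n []       _  = [] , []
    encodeSp n (t ∷ sp) le =
      let u , d   = encode n t (≤-trans (m≤m+n (size t) (sizeSp sp)) le)
          us , ds = encodeSp n sp (≤-trans (m≤n+m (sizeSp sp) (size t)) le)
      in u ∷ us , d ∷ ds

    encodeAll : ∀ n {τs} (ss : All Term τs) → All (λ (_ , s) → size s ≤ n) (toList ss) →
                Σ (All FTm τs) (toList ss ↦*_)
    encodeAll n []       []         = [] , []
    encodeAll n (s ∷ ss) (le ∷ les) =
      let u , d   = encode n s le
          us , ds = encodeAll n ss les
      in u ∷ us , d ∷ ds

  mutual
    ↦-deterministic : {t : Term τ} {u u′ : FTm τ} → t ↦ u → t ↦ u′ → u ≡ u′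
    ↦-deterministic (sym ds) (sym ds′) =
      cong (λ us → fsym _ _ _ us _) (↦ˢ-deterministic ds ds′)
    ↦-deterministic (lam ds) (lam ds′) = cong (fun _ _) (↦*-deterministic ds ds′)

    ↦ˢ-deterministic : {sp : Sp false [] σ τ} {us us′ : FArgs σ τ} →
                       sp ↦ˢ us → sp ↦ˢ us′ → us ≡ us′
    ↦ˢ-deterministic []       []         = refl
    ↦ˢ-deterministic (d ∷ ds) (d′ ∷ ds′) =
      cong₂ _∷_ (↦-deterministic d d′) (↦ˢ-deterministic ds ds′)

    ↦*-deterministic : {l : List Sub} {τs : List GTy} {us us′ : All FTm τs} →
                       l ↦* us → l ↦* us′ → us ≡ us′
    ↦*-deterministic []       []         = refl
    ↦*-deterministic (d ∷ ds) (d′ ∷ ds′) =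
      cong₂ _∷_ (↦-deterministic d d′) (↦*-deterministic ds ds′)

  mutual
    decode : (u : FTm τ) → ∃ (_↦ u)
    decode (fsym f ts ps us β) =
      let sp , ds = decodeSp us in sym f ts ps sp β , sym ds
    decode (fun c w us) =
      -- w is irrelevant, so the shape of c is recomputed by deciding it.
      let ss , ds = decodeAll us
          isCut   = recompute (isCutIn? c) (isFunExpr⇒isCutIn w)
      in fill c ss , ↦-fun⁺ (fill c ss) (cutIn-fill c isCut ss) ds

    decodeSp : (us : FArgs σ τ) → ∃ (_↦ˢ us)
    decodeSp []       = [] , []
    decodeSp (u ∷ us) =
      let t , d   = decode u
          sp , ds = decodeSp us
      in t ∷ sp , d ∷ ds

    decodeAll : {τs : List GTy} (us : All FTm τs) → Σ (All Term τs) λ ss → toList ss ↦* us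
    decodeAll []       = [] , []
    decodeAll (u ∷ us) =
      let t , d   = decode u
          ss , ds = decodeAll us
      in t ∷ ss , d ∷ ds

  mutual
    ↦-injective : {t t′ : Term τ} {u : FTm τ} → t ↦ u → t′ ↦ u → t ≡ t′
    ↦-injective (sym ds) (sym ds′) = cong (λ sp → sym _ _ _ sp _) (↦ˢ-injective ds ds′)
    ↦-injective {t = t} {t′} {u = fun c _ _} d d′ =
      let l  , cut≡  , ds  = ↦-fun⁻ d
          l′ , cut≡′ , ds′ = ↦-fun⁻ d′
      in cutIn-injective t t′ (begin
           cutIn t  ≡⟨ cut≡ ⟩
           (c , l)  ≡⟨ cong (c ,_) (↦*-injective ds ds′) ⟩
           (c , l′) ≡⟨ ≡-sym cut≡′ ⟩
           cutIn t′ ∎)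

    ↦ˢ-injective : {sp sp′ : Sp false [] σ τ} {us : FArgs σ τ} →
                   sp ↦ˢ us → sp′ ↦ˢ us → sp ≡ sp′
    ↦ˢ-injective []       []         = refl
    ↦ˢ-injective (d ∷ ds) (d′ ∷ ds′) =
      cong₂ _∷_ (↦-injective d d′) (↦ˢ-injective ds ds′)

    ↦*-injective : {l l′ : List Sub} {τs : List GTy} {us : All FTm τs} →
                   l ↦* us → l′ ↦* us → l ≡ l′
    ↦*-injective []       []         = refl
    ↦*-injective (d ∷ ds) (d′ ∷ ds′) =
      cong₂ _∷_ (cong (_ ,_) (↦-injective d d′)) (↦*-injective ds ds′)

  encoding-unique : (t : Term τ) → ∃! _≡_ (t ↦_)
  encoding-unique t = let u , d = encode (size t) t ≤-refl in u , d , ↦-deterministic d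

  decoding-unique : (u : FTm τ) → ∃! _≡_ (_↦ u)
  decoding-unique u = let t , d = decode u in t , d , ↦-injective d

lemma3p26 : (S : Signature) → let open Enc S in
    (τ : GTy) →
      ((t : Term τ) → ∃! _≡_ (λ (u : FTm τ) → t ↦ u)) ×
      ((u : FTm τ) → ∃! _≡_ (λ (t : Term τ) → t ↦ u))
lemma3p26 S τ = encoding-unique , decoding-unique
  where open Encoding S
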